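{- Let $N=nm$ where $n,m$ are odd, coprime natural numbers different from $1$. Then there exists an integer $1\le k\le N-1$ coprime to $N$ such that the $\overline k$-monomial minimal solution of $(E_N)$ is reducible and has size $2nm$.
   Context: For an integer $N\ge 2$ and $a_1,\dots,a_n\in\mathbb{Z}/N\mathbb{Z}$, set $M_n(a_1,\dots,a_n)=\begin{pmatrix}a_n&-1\\1&0\end{pmatrix}\cdots\begin{pmatrix}a_1&-1\\1&0\end{pmatrix}\in SL_2(\mathbb{Z}/N\mathbb{Z})$. The equation $(E_N)$ is $M_n(a_1,\dots,a_n)=\pm \mathrm{Id}$; an $n$-tuple satisfying it is a solution of size $n$. Define $(a_1,\dots,a_n)\oplus(b_1,\dots,b_m)=(a_1+b_m,a_2,\dots,a_{n-1},a_n+b_1,b_2,\dots,b_{m-1})$, and $(a_1,\dots,a_n)\sim(b_1,\dots,b_n)$ if $(b_1,\dots,b_n)$ is a cyclic permutation of $(a_1,\dots,a_n)$ or of $(a_n,\dots,a_1)$. A solution $(c_1,\dots,c_n)$ of $(E_N)$ with $n\ge 3$ is reducible if there exist a solution $(b_1,\dots,b_l)$ of $(E_N)$ and an $m$-tuple $(a_1,\dots,a_m)$ with $m\ge3$, $l\ge 3$ and $(c_1,\dots,c_n)\sim(a_1,\dots,a_m)\oplus(b_1,\dots,b_l)$. The $\overline k$-monomial minimal solution of $(E_N)$ is $(\overline k,\dots,\overline k)$ of the least positive length for which it solves $(E_N)$. -}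

module Defs where

open import Data.Nat as ℕ using (ℕ; zero; suc; _<_)
open import Data.Integer as ℤ using (ℤ; +_; _+_; _*_; _-_; -_)
open import Data.Integer.Divisibility using (_∣_)
open import Data.List as List using (List; []; _∷_; replicate; length; drop; take; reverse; foldl)
open import Data.List.Relation.Binary.Pointwise using (Pointwise)
open import Data.Vec as Vec using (Vec)
open import Data.Product using (Σ; ∃; _×_; _,_)
open import Data.Sum using (_⊎_)

-- Integers are used as representatives of Z/NZ; "x = y in Z/NZ" is x ≡ y (mod N).
_≡_[mod_] : ℤ → ℤ → ℕ → Set
x ≡ y [mod N ] = (+ N) ∣ (x - y)

record Mat : Set where
  constructor mat
  field
    e11 e12 e21 e22 : ℤ

_⊗_ : Mat → Mat → Mat
mat a b c d ⊗ mat a' b' c' d' =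
  mat (a * a' + b * c') (a * b' + b * d') (c * a' + d * c') (c * b' + d * d')

Mᵢ : ℤ → Mat
Mᵢ a = mat a (- + 1) (+ 1) (+ 0)

Idm : Mat
Idm = mat (+ 1) (+ 0) (+ 0) (+ 1)

-- M_n(a_1,...,a_n) = M(a_n) ... M(a_1), for the list a_1 ∷ ... ∷ a_n
Mₙ : List ℤ → Mat
Mₙ = foldl (λ acc a → Mᵢ a ⊗ acc) Idm

MatEqMod : ℕ → Mat → Mat → Set
MatEqMod N (mat a b c d) (mat a' b' c' d') =
  (a ≡ a' [mod N ]) × (b ≡ b' [mod N ]) × (c ≡ c' [mod N ]) × (d ≡ d' [mod N ])

negM : Mat → Mat
negM (mat a b c d) = mat (- a) (- b) (- c) (- d)

IsSolution : ℕ → List ℤ → Set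
IsSolution N as = MatEqMod N (Mₙ as) Idm ⊎ MatEqMod N (Mₙ as) (negM Idm)

ListEqMod : ℕ → List ℤ → List ℤ → Set
ListEqMod N = Pointwise (λ x y → x ≡ y [mod N ])

rotate : ℕ → List ℤ → List ℤ
rotate i xs = drop i xs List.++ take i xs

_∼[_]_ : List ℤ → ℕ → List ℤ → Set
as ∼[ N ] bs = Σ ℕ λ i → (i < length as) ×
  (ListEqMod N bs (rotate i as) ⊎ ListEqMod N bs (rotate i (reverse as)))

-- (a_1..a_m) ⊕ (b_1..b_l) = (a_1+b_l, a_2..a_{m-1}, a_m+b_1, b_2..b_{l-1})
_⊕_ : ∀ {m l} → Vec ℤ (suc (suc m)) → Vec ℤ (suc (suc l)) → List ℤ
a ⊕ b = (Vec.head a + Vec.last b) ∷ Vec.toList (Vec.init (Vec.tail a))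
        List.++ ((Vec.last a + Vec.head b) ∷ Vec.toList (Vec.init (Vec.tail b)))

-- reducible solution (size n ≥ 3); tuples a, b have sizes m+2 ≥ 3, l+2 ≥ 3
Reducible : ℕ → List ℤ → Set
Reducible N c = (3 ℕ.≤ length c) × IsSolution N c ×
  Σ ℕ λ m → Σ ℕ λ l → Σ (Vec ℤ (suc (suc m))) λ a → Σ (Vec ℤ (suc (suc l))) λ b →
    (1 ℕ.≤ m) × (1 ℕ.≤ l) × IsSolution N (Vec.toList b) × (c ∼[ N ] (a ⊕ b))

IsMonomialMinimal : ℕ → ℕ → ℕ → Set
IsMonomialMinimal N k s = (1 ℕ.≤ s) × IsSolution N (replicate s (+ k)) ×
  (∀ j → 1 ℕ.≤ j → j < s → IsSolution N (replicate j (+ k)) → Data.Empty.⊥)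
  where import Data.Empty

{-# OPTIONS --safe #-}
-- Take k ≡ 2 (mod n) and k ≡ −2 (mod m); it is coprime to nm because n and m are odd.
-- Modulo n, M(k)^j ≡ M(2)^j = (1+j, −j; j, 1−j), and modulo m, M(k)^j ≡ M(−2)^j = (−1)^j (1+j, j; −j, 1−j).
-- As neither n nor m divides 2, M(k)^j ≡ ±Id (mod nm) forces the sign +, n ∣ j, m ∣ j and j even,
-- so the minimal solution has size 2nm. For reducibility take an odd J ≡ 0 (mod n), J ≡ −2 (mod m)
-- with J + 3 ≤ 2nm. Then M(k)^J = (p q; r s) has p ≡ 1 (mod nm), and since ps − qr = 1 this gives
-- M(r) M(k)^J M(−q) ≡ −Id: the tuple (−q, k, …, k, r) is a solution, and (k, …, k) of size 2nm is
-- its ⊕-sum with (k − r, k, …, k, k + q).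
module Submission where

open import Defs
open import Data.Nat using (ℕ; _*_; _≤_; _∸_)
open import Relation.Binary.PropositionalEquality using (_≢_)
open import Data.Nat.Divisibility using (_∣_)
open import Data.Nat.Coprimality using (Coprime)
open import Data.Integer using (+_)
open import Data.List using (replicate)
open import Data.Product using (Σ; _×_)
open import Relation.Nullary using (¬_)

open import Data.Nat as ℕ using (zero; suc; _<_; NonZero; z≤n; s≤s)
import Data.Nat.Properties as ℕₚ
open import Data.Nat.Divisibility
  using (divides; _∣?_; _∣0; ∣-refl; ∣-trans; ∣⇒≤; ∣m+n∣m⇒∣n; ∣m∣n⇒∣m+n; m∣m*n; n∣m*n; n∣m*n*o; *-monoʳ-∣; ∣1⇒≡1)
import Data.Nat.Coprimality as Coprime
open import Data.Nat.Primality using (prime[2]; prime⇒irreducible)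
open import Data.Integer using (ℤ; -_; _+_; _-_; 0ℤ; 1ℤ; -1ℤ; _^_) renaming (_*_ to _·_)
import Data.Integer.Properties as ℤₚ
import Data.Integer.Coprimality as ℤ
open import Data.Integer.Divisibility.Signed as ℤ∣ using (∣ᵤ⇒∣; ∣⇒∣ᵤ) renaming (_∣_ to _∣ᵢ_)
open import Data.Integer.DivMod using (_%ℕ_; _/ℕ_; n%ℕd<d; a≡a%ℕn+[a/ℕn]*n)
open import Data.Integer.Tactic.RingSolver using (solve-∀)
open import Data.Nat.Tactic.RingSolver using () renaming (solve-∀ to solve-∀ℕ)
open import Data.Nat.GCD using (module Bézout)
open import Data.List using (List; []; _∷_; _++_; [_]; foldl; length)
import Data.List.Properties as Listₚ
open import Data.List.Relation.Binary.Pointwise as Pointwise using (Pointwise; []; _∷_)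
open import Data.Vec as Vec using (Vec; _∷ʳ_)
import Data.Vec.Properties as Vecₚ
open import Data.Product using (∃-syntax; _,_; proj₁; proj₂)
open import Data.Sum using (inj₁; inj₂)
open import Function using (_∘_; _⇔_; mk⇔; Equivalence)
open import Level using (0ℓ)
open import Relation.Binary using (Setoid)
import Relation.Binary.Reasoning.Setoid as SetoidReasoning
open import Relation.Binary.PropositionalEquality
  using (_≡_; refl; sym; trans; cong; cong₂; subst; subst₂; module ≡-Reasoning)
open import Relation.Nullary using (yes; no; contradiction)
open Mat

private
  variable
    a b c d e j : ℕ
    x y z x′ y′ : ℤ
    xs ys : List ℤ
    A B C A′ B′ : Mat

odd⇒nonZero : ¬ 2 ∣ d → NonZero d
odd⇒nonZero {d = zero} 2∤0 = contradiction (2 ∣0) 2∤0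
odd⇒nonZero {d = suc _} _ = _

odd⇒3≤ : ¬ 2 ∣ d → d ≢ 1 → 3 ≤ d
odd⇒3≤ {d = 0} 2∤0 _ = contradiction (2 ∣0) 2∤0
odd⇒3≤ {d = 1} _ 1≢1 = contradiction refl 1≢1
odd⇒3≤ {d = 2} 2∤2 _ = contradiction ∣-refl 2∤2
odd⇒3≤ {d = suc (suc (suc _))} _ _ = s≤s (s≤s (s≤s z≤n))

3≤⇒∤2 : 3 ≤ d → ¬ d ∣ 2
3≤⇒∤2 3≤d d∣2 = ℕₚ.<⇒≱ 3≤d (∣⇒≤ d∣2)

odd⇒coprime-2 : ¬ 2 ∣ d → Coprime 2 d
odd⇒coprime-2 2∤d (e∣2 , e∣d) with prime⇒irreducible prime[2] e∣2
... | inj₁ e≡1 = e≡1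
... | inj₂ refl = contradiction e∣d 2∤d

coprime-* : Coprime a b → Coprime a c → Coprime a (b * c)
coprime-* {a} {b} a⊥b a⊥c {e} (e∣a , e∣bc) = a⊥c (e∣a , Coprime.coprime-divisor e⊥b e∣bc)
  where
  e⊥b : Coprime e b
  e⊥b (f∣e , f∣b) = a⊥b (∣-trans f∣e e∣a , f∣b)

*-∣-coprime : Coprime a b → a ∣ c → b ∣ c → a * b ∣ c
*-∣-coprime {a} {b} a⊥b (divides q refl) b∣qa =
  subst (a * b ∣_) (ℕₚ.*-comm a q)
    (*-monoʳ-∣ a (Coprime.coprime-divisor (Coprime.sym a⊥b) (subst (b ∣_) (ℕₚ.*-comm q a) b∣qa)))

∣-∣-<⇒+≤ : d ∣ a → d ∣ b → a < b → a ℕ.+ d ≤ b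
∣-∣-<⇒+≤ {a = a} d∣a d∣b a<b with ℕₚ.m≤n⇒∃[o]m+o≡n (ℕₚ.<⇒≤ a<b)
... | zero  , refl = contradiction (subst (a <_) (ℕₚ.+-identityʳ a) a<b) (ℕₚ.n≮n a)
... | suc _ , refl = ℕₚ.+-monoʳ-≤ a (∣⇒≤ (∣m+n∣m⇒∣n d∣b d∣a))

-1^-even : 2 ∣ j → -1ℤ ^ j ≡ 1ℤ
-1^-even (divides q refl) = begin
  -1ℤ ^ (q * 2)     ≡⟨ cong (-1ℤ ^_) (ℕₚ.*-comm q 2) ⟩
  -1ℤ ^ (2 * q)     ≡⟨ ℤₚ.^-*-assoc -1ℤ 2 q ⟨
  (-1ℤ ^ 2) ^ q     ≡⟨ ℤₚ.^-zeroˡ q ⟩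
  1ℤ                ∎
  where open ≡-Reasoning

-1^-odd : ¬ 2 ∣ j → -1ℤ ^ j ≡ -1ℤ
-1^-odd {j = zero} 2∤0 = contradiction (2 ∣0) 2∤0
-1^-odd {j = 1} _ = refl
-1^-odd {j = suc (suc j)} 2∤2+j = begin
  -1ℤ ^ (2 ℕ.+ j)   ≡⟨ ℤₚ.^-distribˡ-+-* -1ℤ 2 j ⟩
  1ℤ · -1ℤ ^ j      ≡⟨ ℤₚ.*-identityˡ (-1ℤ ^ j) ⟩
  -1ℤ ^ j           ≡⟨ -1^-odd (2∤2+j ∘ ∣m∣n⇒∣m+n ∣-refl) ⟩
  -1ℤ               ∎
  where open ≡-Reasoning

-- Congruences of integers

infix 4 _≡_⟨mod_⟩

-- Defs' `x ≡ y [mod d ]` with signed divisibility, which has the richer library, and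
-- wrapped in a record so that x and y can be inferred from a proof.
record _≡_⟨mod_⟩ (x y : ℤ) (d : ℕ) : Set where
  constructor ≡mod
  field ∣x-y : + d ∣ᵢ x - y
open _≡_⟨mod_⟩

≡mod-by : ∀ x y → + d ∣ᵢ z → z ≡ x - y → x ≡ y ⟨mod d ⟩
≡mod-by {d} x y d∣z z≡x-y = ≡mod (subst (+ d ∣ᵢ_) z≡x-y d∣z)

≡mod-refl : x ≡ x ⟨mod d ⟩
≡mod-refl {x = x} = ≡mod-by x x (ℤ∣.divides 0ℤ refl) (sym (ℤₚ.+-inverseʳ x))

≡mod-reflexive : x ≡ y → x ≡ y ⟨mod d ⟩
≡mod-reflexive refl = ≡mod-refl

≡mod-sym : x ≡ y ⟨mod d ⟩ → y ≡ x ⟨mod d ⟩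
≡mod-sym {x = x} {y = y} (≡mod p) = ≡mod-by y x (ℤ∣.∣m⇒∣-m p) (negate x y)
  where
  negate : ∀ x y → - (x - y) ≡ y - x
  negate = solve-∀

≡mod-trans : x ≡ y ⟨mod d ⟩ → y ≡ z ⟨mod d ⟩ → x ≡ z ⟨mod d ⟩
≡mod-trans {x = x} {y = y} {z = z} (≡mod p) (≡mod q) = ≡mod-by x z (ℤ∣.∣m∣n⇒∣m+n p q) (telescope x y z)
  where
  telescope : ∀ x y z → (x - y) + (y - z) ≡ x - z
  telescope = solve-∀

+-cong-mod : x ≡ x′ ⟨mod d ⟩ → y ≡ y′ ⟨mod d ⟩ → x + y ≡ x′ + y′ ⟨mod d ⟩
+-cong-mod {x = x} {x′ = x′} {y = y} {y′ = y′} (≡mod p) (≡mod q) =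
  ≡mod-by (x + y) (x′ + y′) (ℤ∣.∣m∣n⇒∣m+n p q) (regroup x x′ y y′)
  where
  regroup : ∀ x x′ y y′ → (x - x′) + (y - y′) ≡ (x + y) - (x′ + y′)
  regroup = solve-∀

·-cong-mod : x ≡ x′ ⟨mod d ⟩ → y ≡ y′ ⟨mod d ⟩ → x · y ≡ x′ · y′ ⟨mod d ⟩
·-cong-mod {x = x} {x′ = x′} {y = y} {y′ = y′} (≡mod p) (≡mod q) =
  ≡mod-by (x · y) (x′ · y′) (ℤ∣.∣m∣n⇒∣m+n (ℤ∣.∣n⇒∣m*n y p) (ℤ∣.∣n⇒∣m*n x′ q)) (regroup x x′ y y′)
  where
  regroup : ∀ x x′ y y′ → y · (x - x′) + x′ · (y - y′) ≡ x · y - x′ · y′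
  regroup = solve-∀

+-congˡ-mod : ∀ x → y ≡ y′ ⟨mod d ⟩ → x + y ≡ x + y′ ⟨mod d ⟩
+-congˡ-mod x = +-cong-mod (≡mod-refl {x = x})

·-congˡ-mod : ∀ x → y ≡ y′ ⟨mod d ⟩ → x · y ≡ x · y′ ⟨mod d ⟩
·-congˡ-mod x = ·-cong-mod (≡mod-refl {x = x})

-‿cong-mod : x ≡ y ⟨mod d ⟩ → - x ≡ - y ⟨mod d ⟩
-‿cong-mod {x = x} {y = y} (≡mod p) = ≡mod-by (- x) (- y) (ℤ∣.∣m⇒∣-m p) (negate x y)
  where
  negate : ∀ x y → - (x - y) ≡ - x - - y
  negate = solve-∀

≡mod⇒[mod] : x ≡ y ⟨mod d ⟩ → x ≡ y [mod d ]
≡mod⇒[mod] = ∣⇒∣ᵤ ∘ ∣x-y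

[mod]⇒≡mod : x ≡ y [mod d ] → x ≡ y ⟨mod d ⟩
[mod]⇒≡mod = ≡mod ∘ ∣ᵤ⇒∣

[mod]-refl : ∀ x → x ≡ x [mod d ]
[mod]-refl x = ≡mod⇒[mod] (≡mod-refl {x = x})

≡mod-setoid : ℕ → Setoid 0ℓ 0ℓ
≡mod-setoid d = record
  { Carrier = ℤ
  ; _≈_ = _≡_⟨mod d ⟩
  ; isEquivalence = record { refl = ≡mod-refl ; sym = ≡mod-sym ; trans = ≡mod-trans }
  }

module ≡mod-Reasoning (d : ℕ) = SetoidReasoning (≡mod-setoid d)

≡mod-∣ : e ∣ d → x ≡ y ⟨mod d ⟩ → x ≡ y ⟨mod e ⟩
≡mod-∣ e∣d (≡mod p) = ≡mod (ℤ∣.∣-trans (∣ᵤ⇒∣ e∣d) p)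

≡mod-* : Coprime d e → x ≡ y ⟨mod d ⟩ → x ≡ y ⟨mod e ⟩ → x ≡ y ⟨mod d * e ⟩
≡mod-* d⊥e (≡mod p) (≡mod q) = ≡mod (∣ᵤ⇒∣ (*-∣-coprime d⊥e (∣⇒∣ᵤ p) (∣⇒∣ᵤ q)))

∣-≡mod : e ∣ d → x ≡ y ⟨mod d ⟩ → + e ∣ᵢ x → + e ∣ᵢ y
∣-≡mod {e = e} {x = x} {y = y} e∣d (≡mod p) e∣x =
  subst (+ e ∣ᵢ_) (cancel x y) (ℤ∣.∣m∣n⇒∣m-n e∣x (ℤ∣.∣-trans (∣ᵤ⇒∣ e∣d) p))
  where
  cancel : ∀ x y → x - (x - y) ≡ y
  cancel = solve-∀

≡0-mod⇒∣ : + j ≡ 0ℤ ⟨mod d ⟩ → d ∣ j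
≡0-mod⇒∣ {j = j} {d = d} (≡mod p) = ∣⇒∣ᵤ (subst (+ d ∣ᵢ_) (ℤₚ.+-identityʳ (+ j)) p)

∣⇒≡0-mod : d ∣ j → + j ≡ 0ℤ ⟨mod d ⟩
∣⇒≡0-mod {j = j} d∣j = ≡mod-by (+ j) 0ℤ (∣ᵤ⇒∣ d∣j) (sym (ℤₚ.+-identityʳ (+ j)))

1≡-1-mod⇒∣2 : 1ℤ ≡ -1ℤ ⟨mod d ⟩ → d ∣ 2
1≡-1-mod⇒∣2 (≡mod p) = ∣⇒∣ᵤ p

≡1-mod-2⇒odd : + j ≡ 1ℤ ⟨mod 2 ⟩ → ¬ 2 ∣ j
≡1-mod-2⇒odd j≡1 2∣j with ∣1⇒≡1 (∣⇒∣ᵤ (∣-≡mod ∣-refl j≡1 (∣ᵤ⇒∣ 2∣j)))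
... | ()

≡mod-coprime : x ≡ y ⟨mod d ⟩ → ℤ.Coprime y (+ d) → ℤ.Coprime x (+ d)
≡mod-coprime x≡y y⊥d (e∣x , e∣d) = y⊥d (∣⇒∣ᵤ (∣-≡mod e∣d x≡y (∣ᵤ⇒∣ e∣x)) , e∣d)

reduce-mod : (z : ℤ) (d : ℕ) .{{_ : NonZero d}} → ∃[ r ] r < d × + r ≡ z ⟨mod d ⟩
reduce-mod z d = r , n%ℕd<d z d , ≡mod-by (+ r) z (ℤ∣.∣m⇒∣-m (ℤ∣.∣n⇒∣m*n q ℤ∣.∣-refl)) (begin
  - (q · + d)              ≡⟨ cancel (+ r) (q · + d) ⟩
  + r - (+ r + q · + d)    ≡⟨ cong (λ w → + r - w) (a≡a%ℕn+[a/ℕn]*n z d) ⟨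
  + r - z                  ∎)
  where
  open ≡-Reasoning
  r = z %ℕ d
  q = z /ℕ d
  cancel : ∀ r s → - s ≡ r - (r + s)
  cancel = solve-∀

suc-multiple≡1-mod : ∀ q → + (1 ℕ.+ q * d) ≡ 1ℤ ⟨mod d ⟩
suc-multiple≡1-mod {d} q = ≡mod-by (+ (1 ℕ.+ q * d)) 1ℤ (∣ᵤ⇒∣ (n∣m*n q)) refl

coprime⇒idempotent : Coprime d e → ∃[ f ] f ≡ 0ℤ ⟨mod d ⟩ × f ≡ 1ℤ ⟨mod e ⟩
coprime⇒idempotent {d} {e} d⊥e with Coprime.coprime-Bézout d⊥e
... | Bézout.+- p q 1+qe≡pd =
  + (p * d) , ∣⇒≡0-mod (n∣m*n p) , subst (λ r → + r ≡ 1ℤ ⟨mod e ⟩) 1+qe≡pd (suc-multiple≡1-mod q)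
... | Bézout.-+ p q 1+pd≡qe =
  1ℤ - + (q * e) ,
  +-congˡ-mod 1ℤ (-‿cong-mod (subst (λ r → + r ≡ 1ℤ ⟨mod d ⟩) 1+pd≡qe (suc-multiple≡1-mod p))) ,
  +-congˡ-mod 1ℤ (-‿cong-mod (∣⇒≡0-mod (n∣m*n q)))

crtℤ : Coprime d e → (u v : ℤ) → ∃[ x ] x ≡ u ⟨mod d ⟩ × x ≡ v ⟨mod e ⟩
crtℤ {d} {e} d⊥e u v with coprime⇒idempotent d⊥e
... | f , f≡0 , f≡1 = u + (v - u) · f , ≡u , ≡v
  where
  ≡u : u + (v - u) · f ≡ u ⟨mod d ⟩
  ≡u = begin
    u + (v - u) · f    ≈⟨ +-congˡ-mod u (·-congˡ-mod (v - u) f≡0) ⟩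
    u + (v - u) · 0ℤ   ≡⟨ cong (λ w → u + w) (ℤₚ.*-zeroʳ (v - u)) ⟩
    u + 0ℤ             ≡⟨ ℤₚ.+-identityʳ u ⟩
    u                  ∎
    where open ≡mod-Reasoning d
  ≡v : u + (v - u) · f ≡ v ⟨mod e ⟩
  ≡v = begin
    u + (v - u) · f    ≈⟨ +-congˡ-mod u (·-congˡ-mod (v - u) f≡1) ⟩
    u + (v - u) · 1ℤ   ≡⟨ cancel u v ⟩
    v                  ∎
    where
    open ≡mod-Reasoning e
    cancel : ∀ u v → u + (v - u) · 1ℤ ≡ v
    cancel = solve-∀

crt : Coprime d e → .{{_ : NonZero (d * e)}} → (u v : ℤ) →
      ∃[ r ] r < d * e × + r ≡ u ⟨mod d ⟩ × + r ≡ v ⟨mod e ⟩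
crt {d} {e} d⊥e u v =
  let x , x≡u , x≡v = crtℤ d⊥e u v
      r , r<de , r≡x = reduce-mod x (d * e)
  in r , r<de , ≡mod-trans (≡mod-∣ (m∣m*n e) r≡x) x≡u , ≡mod-trans (≡mod-∣ (n∣m*n d) r≡x) x≡v

mat-cong : ∀ {p q r s p′ q′ r′ s′} → p ≡ p′ → q ≡ q′ → r ≡ r′ → s ≡ s′ → mat p q r s ≡ mat p′ q′ r′ s′
mat-cong refl refl refl refl = refl

⊗-assoc : ∀ A B C → (A ⊗ B) ⊗ C ≡ A ⊗ (B ⊗ C)
⊗-assoc (mat a b c d) (mat p q r s) (mat x y z w) =
  mat-cong (entry a b p q r s x z) (entry a b p q r s y w) (entry c d p q r s x z) (entry c d p q r s y w)
  where
  entry : ∀ a b p q r s x z → (a · p + b · r) · x + (a · q + b · s) · z ≡ a · (p · x + q · z) + b · (r · x + s · z)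
  entry = solve-∀

⊗-identityˡ : ∀ A → Idm ⊗ A ≡ A
⊗-identityˡ (mat p q r s) = mat-cong (first p r) (first q s) (second p r) (second q s)
  where
  first : ∀ p r → 1ℤ · p + 0ℤ · r ≡ p
  first = solve-∀
  second : ∀ p r → 0ℤ · p + 1ℤ · r ≡ r
  second = solve-∀

⊗-identityʳ : ∀ A → A ⊗ Idm ≡ A
⊗-identityʳ (mat p q r s) = mat-cong (first p q) (second p q) (first r s) (second r s)
  where
  first : ∀ p q → p · 1ℤ + q · 0ℤ ≡ p
  first = solve-∀
  second : ∀ p q → p · 0ℤ + q · 1ℤ ≡ q
  second = solve-∀

det : Mat → ℤ
det (mat p q r s) = p · s - q · r

det-Mᵢ-⊗ : ∀ x A → det (Mᵢ x ⊗ A) ≡ det A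
det-Mᵢ-⊗ x (mat p q r s) = expand x p q r s
  where
  expand : ∀ x p q r s → (x · p + - 1ℤ · r) · (1ℤ · q + 0ℤ · s) - (x · q + - 1ℤ · s) · (1ℤ · p + 0ℤ · r) ≡ p · s - q · r
  expand = solve-∀

infix 4 _≡ₘ_⟨mod_⟩

record _≡ₘ_⟨mod_⟩ (A B : Mat) (d : ℕ) : Set where
  constructor entrywise
  field
    ≡₁₁ : e11 A ≡ e11 B ⟨mod d ⟩
    ≡₁₂ : e12 A ≡ e12 B ⟨mod d ⟩
    ≡₂₁ : e21 A ≡ e21 B ⟨mod d ⟩
    ≡₂₂ : e22 A ≡ e22 B ⟨mod d ⟩
open _≡ₘ_⟨mod_⟩

≡ₘ-refl : A ≡ₘ A ⟨mod d ⟩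
≡ₘ-refl = entrywise ≡mod-refl ≡mod-refl ≡mod-refl ≡mod-refl

≡ₘ-reflexive : A ≡ B → A ≡ₘ B ⟨mod d ⟩
≡ₘ-reflexive refl = ≡ₘ-refl

≡ₘ-sym : A ≡ₘ B ⟨mod d ⟩ → B ≡ₘ A ⟨mod d ⟩
≡ₘ-sym (entrywise p q r s) = entrywise (≡mod-sym p) (≡mod-sym q) (≡mod-sym r) (≡mod-sym s)

≡ₘ-trans : A ≡ₘ B ⟨mod d ⟩ → B ≡ₘ C ⟨mod d ⟩ → A ≡ₘ C ⟨mod d ⟩
≡ₘ-trans (entrywise p q r s) (entrywise p′ q′ r′ s′) =
  entrywise (≡mod-trans p p′) (≡mod-trans q q′) (≡mod-trans r r′) (≡mod-trans s s′)

≡ₘ-∣ : e ∣ d → A ≡ₘ B ⟨mod d ⟩ → A ≡ₘ B ⟨mod e ⟩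
≡ₘ-∣ e∣d (entrywise p q r s) = entrywise (≡mod-∣ e∣d p) (≡mod-∣ e∣d q) (≡mod-∣ e∣d r) (≡mod-∣ e∣d s)

≡ₘ-* : Coprime d e → A ≡ₘ B ⟨mod d ⟩ → A ≡ₘ B ⟨mod e ⟩ → A ≡ₘ B ⟨mod d * e ⟩
≡ₘ-* d⊥e (entrywise p q r s) (entrywise p′ q′ r′ s′) =
  entrywise (≡mod-* d⊥e p p′) (≡mod-* d⊥e q q′) (≡mod-* d⊥e r r′) (≡mod-* d⊥e s s′)

≡ₘ⇒MatEqMod : A ≡ₘ B ⟨mod d ⟩ → MatEqMod d A B
≡ₘ⇒MatEqMod (entrywise p q r s) = ≡mod⇒[mod] p , ≡mod⇒[mod] q , ≡mod⇒[mod] r , ≡mod⇒[mod] s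

MatEqMod⇒≡ₘ : MatEqMod d A B → A ≡ₘ B ⟨mod d ⟩
MatEqMod⇒≡ₘ (p , q , r , s) = entrywise ([mod]⇒≡mod p) ([mod]⇒≡mod q) ([mod]⇒≡mod r) ([mod]⇒≡mod s)

⊗-cong-mod : A ≡ₘ A′ ⟨mod d ⟩ → B ≡ₘ B′ ⟨mod d ⟩ → A ⊗ B ≡ₘ A′ ⊗ B′ ⟨mod d ⟩
⊗-cong-mod (entrywise a₁ a₂ a₃ a₄) (entrywise b₁ b₂ b₃ b₄) = entrywise
  (+-cong-mod (·-cong-mod a₁ b₁) (·-cong-mod a₂ b₃)) (+-cong-mod (·-cong-mod a₁ b₂) (·-cong-mod a₂ b₄))
  (+-cong-mod (·-cong-mod a₃ b₁) (·-cong-mod a₄ b₃)) (+-cong-mod (·-cong-mod a₃ b₂) (·-cong-mod a₄ b₄))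

Mₙ-step : Mat → ℤ → Mat
Mₙ-step A x = Mᵢ x ⊗ A

foldl-Mₙ-step : ∀ A xs → foldl Mₙ-step A xs ≡ Mₙ xs ⊗ A
foldl-Mₙ-step A [] = sym (⊗-identityˡ A)
foldl-Mₙ-step A (x ∷ xs) = begin
  foldl Mₙ-step (Mᵢ x ⊗ A) xs        ≡⟨ foldl-Mₙ-step (Mᵢ x ⊗ A) xs ⟩
  Mₙ xs ⊗ (Mᵢ x ⊗ A)                 ≡⟨ cong (λ B → Mₙ xs ⊗ (B ⊗ A)) (⊗-identityʳ (Mᵢ x)) ⟨
  Mₙ xs ⊗ ((Mᵢ x ⊗ Idm) ⊗ A)         ≡⟨ ⊗-assoc (Mₙ xs) (Mᵢ x ⊗ Idm) A ⟨
  (Mₙ xs ⊗ (Mᵢ x ⊗ Idm)) ⊗ A         ≡⟨ cong (_⊗ A) (foldl-Mₙ-step (Mᵢ x ⊗ Idm) xs) ⟨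
  Mₙ (x ∷ xs) ⊗ A                    ∎
  where open ≡-Reasoning

Mₙ-++ : ∀ xs ys → Mₙ (xs ++ ys) ≡ Mₙ ys ⊗ Mₙ xs
Mₙ-++ xs ys = trans (Listₚ.foldl-++ Mₙ-step Idm xs ys) (foldl-Mₙ-step (Mₙ xs) ys)

Mₙ-∷ : ∀ x xs → Mₙ (x ∷ xs) ≡ Mₙ xs ⊗ Mᵢ x
Mₙ-∷ x xs = trans (Mₙ-++ [ x ] xs) (cong (Mₙ xs ⊗_) (⊗-identityʳ (Mᵢ x)))

Mₙ-border : ∀ x xs y → Mₙ (x ∷ xs ++ [ y ]) ≡ Mᵢ y ⊗ (Mₙ xs ⊗ Mᵢ x)
Mₙ-border x xs y = begin
  Mₙ ((x ∷ xs) ++ [ y ])        ≡⟨ Mₙ-++ (x ∷ xs) [ y ] ⟩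
  (Mᵢ y ⊗ Idm) ⊗ Mₙ (x ∷ xs)    ≡⟨ cong₂ _⊗_ (⊗-identityʳ (Mᵢ y)) (Mₙ-∷ x xs) ⟩
  Mᵢ y ⊗ (Mₙ xs ⊗ Mᵢ x)         ∎
  where open ≡-Reasoning

det-foldl-Mₙ-step : ∀ A xs → det (foldl Mₙ-step A xs) ≡ det A
det-foldl-Mₙ-step A [] = refl
det-foldl-Mₙ-step A (x ∷ xs) = trans (det-foldl-Mₙ-step (Mᵢ x ⊗ A) xs) (det-Mᵢ-⊗ x A)

det-Mₙ : ∀ xs → det (Mₙ xs) ≡ 1ℤ
det-Mₙ = det-foldl-Mₙ-step Idm

Mᵢ-cong-mod : x ≡ y ⟨mod d ⟩ → Mᵢ x ≡ₘ Mᵢ y ⟨mod d ⟩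
Mᵢ-cong-mod x≡y = entrywise x≡y ≡mod-refl ≡mod-refl ≡mod-refl

foldl-Mₙ-step-cong-mod : A ≡ₘ B ⟨mod d ⟩ → Pointwise _≡_⟨mod d ⟩ xs ys →
                         foldl Mₙ-step A xs ≡ₘ foldl Mₙ-step B ys ⟨mod d ⟩
foldl-Mₙ-step-cong-mod A≡B [] = A≡B
foldl-Mₙ-step-cong-mod A≡B (x≡y ∷ xs≡ys) =
  foldl-Mₙ-step-cong-mod (⊗-cong-mod (Mᵢ-cong-mod x≡y) A≡B) xs≡ys

Mₙ-replicate-cong-mod : x ≡ y ⟨mod d ⟩ → ∀ j → Mₙ (replicate j x) ≡ₘ Mₙ (replicate j y) ⟨mod d ⟩
Mₙ-replicate-cong-mod x≡y j = foldl-Mₙ-step-cong-mod ≡ₘ-refl (Pointwise.replicate⁺ x≡y j)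

-- Powers of M(2) and M(-2)

twoPower : ℤ → Mat
twoPower x = mat (1ℤ + x) (- x) x (1ℤ - x)

minusTwoPower : ℤ → ℤ → Mat
minusTwoPower s x = mat (s · (1ℤ + x)) (s · x) (s · - x) (s · (1ℤ - x))

Mₙ-replicate-2 : ∀ j → Mₙ (replicate j (+ 2)) ≡ twoPower (+ j)
Mₙ-replicate-2 zero = refl
Mₙ-replicate-2 (suc j) = begin
  Mₙ (replicate (suc j) (+ 2))        ≡⟨ Mₙ-∷ (+ 2) (replicate j (+ 2)) ⟩
  Mₙ (replicate j (+ 2)) ⊗ Mᵢ (+ 2)   ≡⟨ cong (_⊗ Mᵢ (+ 2)) (Mₙ-replicate-2 j) ⟩
  twoPower (+ j) ⊗ Mᵢ (+ 2)           ≡⟨ mat-cong (e₁₁ (+ j)) (e₁₂ (+ j)) (e₂₁ (+ j)) (e₂₂ (+ j)) ⟩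
  twoPower (+ suc j)                  ∎
  where
  open ≡-Reasoning
  e₁₁ : ∀ x → (1ℤ + x) · + 2 + (- x) · 1ℤ ≡ 1ℤ + (1ℤ + x)
  e₁₁ = solve-∀
  e₁₂ : ∀ x → (1ℤ + x) · - 1ℤ + (- x) · 0ℤ ≡ - (1ℤ + x)
  e₁₂ = solve-∀
  e₂₁ : ∀ x → x · + 2 + (1ℤ - x) · 1ℤ ≡ 1ℤ + x
  e₂₁ = solve-∀
  e₂₂ : ∀ x → x · - 1ℤ + (1ℤ - x) · 0ℤ ≡ 1ℤ - (1ℤ + x)
  e₂₂ = solve-∀

Mₙ-replicate-−2 : ∀ j → Mₙ (replicate j (- + 2)) ≡ minusTwoPower (-1ℤ ^ j) (+ j)
Mₙ-replicate-−2 zero = refl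
Mₙ-replicate-−2 (suc j) = begin
  Mₙ (replicate (suc j) (- + 2))                 ≡⟨ Mₙ-∷ (- + 2) (replicate j (- + 2)) ⟩
  Mₙ (replicate j (- + 2)) ⊗ Mᵢ (- + 2)          ≡⟨ cong (_⊗ Mᵢ (- + 2)) (Mₙ-replicate-−2 j) ⟩
  minusTwoPower s (+ j) ⊗ Mᵢ (- + 2)             ≡⟨ mat-cong (e₁₁ s (+ j)) (e₁₂ s (+ j)) (e₂₁ s (+ j)) (e₂₂ s (+ j)) ⟩
  minusTwoPower (-1ℤ · s) (+ suc j)              ∎
  where
  open ≡-Reasoning
  s = -1ℤ ^ j
  e₁₁ : ∀ s x → s · (1ℤ + x) · - + 2 + s · x · 1ℤ ≡ -1ℤ · s · (1ℤ + (1ℤ + x))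
  e₁₁ = solve-∀
  e₁₂ : ∀ s x → s · (1ℤ + x) · - 1ℤ + s · x · 0ℤ ≡ -1ℤ · s · (1ℤ + x)
  e₁₂ = solve-∀
  e₂₁ : ∀ s x → s · - x · - + 2 + s · (1ℤ - x) · 1ℤ ≡ -1ℤ · s · - (1ℤ + x)
  e₂₁ = solve-∀
  e₂₂ : ∀ s x → s · - x · - 1ℤ + s · (1ℤ - x) · 0ℤ ≡ -1ℤ · s · (1ℤ - (1ℤ + x))
  e₂₂ = solve-∀

twoPower-cong-mod : x ≡ y ⟨mod d ⟩ → twoPower x ≡ₘ twoPower y ⟨mod d ⟩
twoPower-cong-mod x≡y = entrywise (+-congˡ-mod 1ℤ x≡y) (-‿cong-mod x≡y) x≡y (+-congˡ-mod 1ℤ (-‿cong-mod x≡y))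

minusTwoPower-cong-mod : ∀ s → x ≡ y ⟨mod d ⟩ → minusTwoPower s x ≡ₘ minusTwoPower s y ⟨mod d ⟩
minusTwoPower-cong-mod s x≡y = entrywise
  (·-congˡ-mod s (+-congˡ-mod 1ℤ x≡y)) (·-congˡ-mod s x≡y)
  (·-congˡ-mod s (-‿cong-mod x≡y)) (·-congˡ-mod s (+-congˡ-mod 1ℤ (-‿cong-mod x≡y)))

twoPower-≡Id⇔ : twoPower (+ j) ≡ₘ Idm ⟨mod d ⟩ ⇔ d ∣ j
twoPower-≡Id⇔ = mk⇔ (≡0-mod⇒∣ ∘ ≡₂₁) (twoPower-cong-mod ∘ ∣⇒≡0-mod)

twoPower-≢-Id : ¬ d ∣ 2 → ¬ twoPower x ≡ₘ negM Idm ⟨mod d ⟩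
twoPower-≢-Id {d} {x} d∤2 (entrywise 1+x≡-1 _ x≡0 _) = d∤2 (1≡-1-mod⇒∣2 (begin
  1ℤ + 0ℤ    ≈⟨ +-congˡ-mod 1ℤ x≡0 ⟨
  1ℤ + x     ≈⟨ 1+x≡-1 ⟩
  -1ℤ        ∎))
  where open ≡mod-Reasoning d

minusTwoPower-≡Id⇔ : ¬ d ∣ 2 → minusTwoPower (-1ℤ ^ j) (+ j) ≡ₘ Idm ⟨mod d ⟩ ⇔ (2 ∣ j × d ∣ j)
minusTwoPower-≡Id⇔ {d} {j} d∤2 = mk⇔ to from
  where
  open ≡mod-Reasoning d
  IdWithSign : ℤ → Set
  IdWithSign s = minusTwoPower s (+ j) ≡ₘ Idm ⟨mod d ⟩
  to : IdWithSign (-1ℤ ^ j) → 2 ∣ j × d ∣ j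
  to ≡Id with 2 ∣? j
  ... | yes 2∣j = 2∣j , ≡0-mod⇒∣ (begin
    + j          ≡⟨ ℤₚ.*-identityˡ (+ j) ⟨
    1ℤ · + j     ≈⟨ ≡₁₂ (subst IdWithSign (-1^-even 2∣j) ≡Id) ⟩
    0ℤ           ∎)
  ... | no 2∤j = contradiction (1≡-1-mod⇒∣2 (≡mod-sym (begin
    -1ℤ · (1ℤ + 0ℤ)      ≈⟨ ·-congˡ-mod -1ℤ (+-congˡ-mod 1ℤ j≡0) ⟨
    -1ℤ · (1ℤ + + j)     ≈⟨ ≡₁₁ ≡Id-odd ⟩
    1ℤ                   ∎))) d∤2
    where
    ≡Id-odd : IdWithSign -1ℤ
    ≡Id-odd = subst IdWithSign (-1^-odd 2∤j) ≡Id
    j≡0 : + j ≡ 0ℤ ⟨mod d ⟩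
    j≡0 = begin
      + j                ≡⟨ ℤₚ.neg-involutive (+ j) ⟨
      - - + j            ≡⟨ cong -_ (ℤₚ.-1*i≡-i (+ j)) ⟨
      - (-1ℤ · + j)      ≈⟨ -‿cong-mod (≡₁₂ ≡Id-odd) ⟩
      0ℤ                 ∎
  from : 2 ∣ j × d ∣ j → IdWithSign (-1ℤ ^ j)
  from (2∣j , d∣j) = subst IdWithSign (sym (-1^-even 2∣j)) (minusTwoPower-cong-mod 1ℤ (∣⇒≡0-mod d∣j))

-- Bordered solutions and reducibility

⊗-Mᵢ-−e₁₂ : ∀ Q → det Q ≡ 1ℤ → e11 Q ≡ 1ℤ ⟨mod d ⟩ →
            Q ⊗ Mᵢ (- e12 Q) ≡ₘ mat 0ℤ -1ℤ 1ℤ (- e21 Q) ⟨mod d ⟩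
⊗-Mᵢ-−e₁₂ (mat p q r s) det≡1 (≡mod d∣p-1) = entrywise
  (≡mod-by _ _ (ℤ∣.∣n⇒∣m*n (- q) d∣p-1) (e₁₁ p q))
  (≡mod-by _ _ (ℤ∣.∣n⇒∣m*n -1ℤ d∣p-1) (e₁₂ p q))
  (≡mod-by _ _ (ℤ∣.∣n⇒∣m*n (- s) d∣p-1) (trans (e₂₁ p q r s) (cong (λ w → r · - q + s · 1ℤ - w) det≡1)))
  (≡mod-reflexive (e₂₂ r s))
  where
  e₁₁ : ∀ p q → - q · (p - 1ℤ) ≡ p · - q + q · 1ℤ - 0ℤ
  e₁₁ = solve-∀
  e₁₂ : ∀ p q → -1ℤ · (p - 1ℤ) ≡ p · - 1ℤ + q · 0ℤ - -1ℤ
  e₁₂ = solve-∀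
  e₂₁ : ∀ p q r s → - s · (p - 1ℤ) ≡ r · - q + s · 1ℤ - (p · s - q · r)
  e₂₁ = solve-∀
  e₂₂ : ∀ r s → r · - 1ℤ + s · 0ℤ ≡ - r
  e₂₂ = solve-∀

Mᵢ-⊗-corner : ∀ r → Mᵢ r ⊗ mat 0ℤ -1ℤ 1ℤ (- r) ≡ negM Idm
Mᵢ-⊗-corner r = mat-cong (e₁₁ r) (e₁₂ r) refl refl
  where
  e₁₁ : ∀ r → r · 0ℤ + - 1ℤ · 1ℤ ≡ -1ℤ
  e₁₁ = solve-∀
  e₁₂ : ∀ r → r · -1ℤ + - 1ℤ · - r ≡ 0ℤ
  e₁₂ = solve-∀

bordering-≡-Id : ∀ Q → det Q ≡ 1ℤ → e11 Q ≡ 1ℤ ⟨mod d ⟩ → Mᵢ (e21 Q) ⊗ (Q ⊗ Mᵢ (- e12 Q)) ≡ₘ negM Idm ⟨mod d ⟩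
bordering-≡-Id Q det≡1 e₁₁≡1 =
  ≡ₘ-trans (⊗-cong-mod (≡ₘ-refl {A = Mᵢ (e21 Q)}) (⊗-Mᵢ-−e₁₂ Q det≡1 e₁₁≡1)) (≡ₘ-reflexive (Mᵢ-⊗-corner (e21 Q)))

bordered-solution : ∀ xs → e11 (Mₙ xs) ≡ 1ℤ ⟨mod d ⟩ → IsSolution d (- e12 (Mₙ xs) ∷ xs ++ [ e21 (Mₙ xs) ])
bordered-solution {d} xs e₁₁≡1 = inj₂ (≡ₘ⇒MatEqMod
  (subst (λ M → M ≡ₘ negM Idm ⟨mod d ⟩) (sym (Mₙ-border (- e12 (Mₙ xs)) xs (e21 (Mₙ xs))))
    (bordering-≡-Id (Mₙ xs) (det-Mₙ xs) e₁₁≡1)))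

replicate-+ : ∀ a b (x : ℤ) → replicate (a ℕ.+ b) x ≡ replicate a x ++ replicate b x
replicate-+ zero    b x = refl
replicate-+ (suc a) b x = cong (x ∷_) (replicate-+ a b x)

reducible-if-bordered : ∀ {J L} → 1 ≤ J → J ℕ.+ 3 ≤ L → IsSolution d (replicate L x) →
                        IsSolution d (y ∷ replicate J x ++ [ z ]) → Reducible d (replicate L x)
reducible-if-bordered {d} {x} {y} {z} {J} {L} 1≤J J+3≤L solution bordered =
  3≤length , solution , suc t , J , left , right , s≤s z≤n , 1≤J ,
  subst (IsSolution d) (sym toList-right) bordered ,
  0 , ℕₚ.<-≤-trans (s≤s z≤n) 3≤length ,
  inj₁ (subst₂ (ListEqMod d) (sym ⊕-left-right) (sym (Listₚ.++-identityʳ (replicate L x)))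
    (Pointwise.refl (λ {x} → [mod]-refl x)))
  where
  t = proj₁ (ℕₚ.m≤n⇒∃[o]m+o≡n J+3≤L)
  J+3+t≡L : J ℕ.+ 3 ℕ.+ t ≡ L
  J+3+t≡L = proj₂ (ℕₚ.m≤n⇒∃[o]m+o≡n J+3≤L)
  3≤length : 3 ≤ length (replicate L x)
  3≤length = subst (3 ≤_) (sym (Listₚ.length-replicate L)) (ℕₚ.≤-trans (ℕₚ.m≤n+m 3 J) J+3≤L)
  left : Vec ℤ (3 ℕ.+ t)
  left = (x - z) Vec.∷ (Vec.replicate (suc t) x ∷ʳ (x - y))
  right : Vec ℤ (2 ℕ.+ J)
  right = y Vec.∷ (Vec.replicate J x ∷ʳ z)
  toList-right : Vec.toList right ≡ y ∷ replicate J x ++ [ z ]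
  toList-right = cong (y ∷_) (trans (Vecₚ.toList-∷ʳ z (Vec.replicate J x)) (cong (_++ [ z ]) (Vecₚ.toList-replicate J x)))
  unfold-⊕ : left ⊕ right ≡ (x - z + z) ∷ replicate (suc t) x ++ (x - y + y) ∷ replicate J x
  unfold-⊕ rewrite Vecₚ.last-∷ʳ z (Vec.replicate J x) | Vecₚ.last-∷ʳ (x - y) (Vec.replicate (suc t) x)
                 | Vecₚ.init-∷ʳ z (Vec.replicate J x) | Vecₚ.init-∷ʳ (x - y) (Vec.replicate t x)
                 | Vecₚ.toList-replicate t x | Vecₚ.toList-replicate J x = refl
  cancel : ∀ x y → x - y + y ≡ x
  cancel = solve-∀
  reorder : ∀ t J → 2 ℕ.+ t ℕ.+ (1 ℕ.+ J) ≡ J ℕ.+ 3 ℕ.+ t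
  reorder = solve-∀ℕ
  length-left-right : 2 ℕ.+ t ℕ.+ (1 ℕ.+ J) ≡ L
  length-left-right = trans (reorder t J) J+3+t≡L
  ⊕-left-right : left ⊕ right ≡ replicate L x
  ⊕-left-right = begin
    left ⊕ right                                                  ≡⟨ unfold-⊕ ⟩
    (x - z + z) ∷ replicate (suc t) x ++ (x - y + y) ∷ replicate J x
      ≡⟨ cong₂ (λ u w → u ∷ replicate (suc t) x ++ w ∷ replicate J x) (cancel x z) (cancel x y) ⟩
    replicate (2 ℕ.+ t) x ++ replicate (1 ℕ.+ J) x                ≡⟨ replicate-+ (2 ℕ.+ t) (1 ℕ.+ J) x ⟨
    replicate (2 ℕ.+ t ℕ.+ (1 ℕ.+ J)) x                          ≡⟨ cong (λ n → replicate n x) length-left-right ⟩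
    replicate L x                                                 ∎
    where open ≡-Reasoning

reducible-if-e₁₁≡1 : ∀ {J L} → 1 ≤ J → J ℕ.+ 3 ≤ L → IsSolution d (replicate L x) →
                     e11 (Mₙ (replicate J x)) ≡ 1ℤ ⟨mod d ⟩ → Reducible d (replicate L x)
reducible-if-e₁₁≡1 {x = x} {J = J} 1≤J J+3≤L solution e₁₁≡1 =
  reducible-if-bordered {y = - e12 (Mₙ (replicate J x))} {z = e21 (Mₙ (replicate J x))} 1≤J J+3≤L solution
    (bordered-solution (replicate J x) e₁₁≡1)

-- The construction for N = n m

module OddCoprimeFactors {n m : ℕ} (2∤n : ¬ 2 ∣ n) (2∤m : ¬ 2 ∣ m) (n⊥m : Coprime n m) (n≢1 : n ≢ 1) (m≢1 : m ≢ 1) where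

  instance
    n≢0 : NonZero n
    n≢0 = odd⇒nonZero 2∤n
    m≢0 : NonZero m
    m≢0 = odd⇒nonZero 2∤m
    nm≢0 : NonZero (n * m)
    nm≢0 = ℕₚ.m*n≢0 n m
    2nm≢0 : NonZero (2 * n * m)
    2nm≢0 = ℕₚ.m*n≢0 (2 * n) m {{ℕₚ.m*n≢0 2 n}}

  3≤n : 3 ≤ n
  3≤n = odd⇒3≤ 2∤n n≢1

  n∤2 : ¬ n ∣ 2
  n∤2 = 3≤⇒∤2 3≤n

  m∤2 : ¬ m ∣ 2
  m∤2 = 3≤⇒∤2 (odd⇒3≤ 2∤m m≢1)

  2⊥nm : Coprime 2 (n * m)
  2⊥nm = coprime-* (odd⇒coprime-2 2∤n) (odd⇒coprime-2 2∤m)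

  2nm∣⇔ : 2 * n * m ∣ j ⇔ (2 ∣ j × n ∣ j × m ∣ j)
  2nm∣⇔ = mk⇔
    (λ 2nm∣j → ∣-trans (∣-trans (m∣m*n n) (m∣m*n m)) 2nm∣j , ∣-trans (n∣m*n*o 2 m) 2nm∣j , ∣-trans (n∣m*n (2 * n)) 2nm∣j)
    (λ (2∣j , n∣j , m∣j) → *-∣-coprime 2n⊥m (*-∣-coprime (odd⇒coprime-2 2∤n) 2∣j n∣j) m∣j)
    where
    2n⊥m : Coprime (2 * n) m
    2n⊥m = Coprime.sym (coprime-* (Coprime.sym (odd⇒coprime-2 2∤m)) (Coprime.sym n⊥m))

  module _ {a : ℤ} (a≡2 : a ≡ + 2 ⟨mod n ⟩) (a≡-2 : a ≡ - + 2 ⟨mod m ⟩) where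

    Mₙ-replicate-mod-n : ∀ j → Mₙ (replicate j a) ≡ₘ twoPower (+ j) ⟨mod n ⟩
    Mₙ-replicate-mod-n j = subst (λ M → Mₙ (replicate j a) ≡ₘ M ⟨mod n ⟩) (Mₙ-replicate-2 j) (Mₙ-replicate-cong-mod a≡2 j)

    Mₙ-replicate-mod-m : ∀ j → Mₙ (replicate j a) ≡ₘ minusTwoPower (-1ℤ ^ j) (+ j) ⟨mod m ⟩
    Mₙ-replicate-mod-m j = subst (λ M → Mₙ (replicate j a) ≡ₘ M ⟨mod m ⟩) (Mₙ-replicate-−2 j) (Mₙ-replicate-cong-mod a≡-2 j)

    monomial-solution⇔ : IsSolution (n * m) (replicate j a) ⇔ 2 * n * m ∣ j
    monomial-solution⇔ {j} = mk⇔ to from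
      where
      mod-n = Mₙ-replicate-mod-n j
      mod-m = Mₙ-replicate-mod-m j
      to : IsSolution (n * m) (replicate j a) → 2 * n * m ∣ j
      to (inj₁ ≡Id) =
        let 2∣j , m∣j = Equivalence.to (minusTwoPower-≡Id⇔ m∤2)
                          (≡ₘ-trans (≡ₘ-sym mod-m) (≡ₘ-∣ (n∣m*n n) (MatEqMod⇒≡ₘ ≡Id)))
            n∣j = Equivalence.to twoPower-≡Id⇔ (≡ₘ-trans (≡ₘ-sym mod-n) (≡ₘ-∣ (m∣m*n m) (MatEqMod⇒≡ₘ ≡Id)))
        in Equivalence.from 2nm∣⇔ (2∣j , n∣j , m∣j)
      to (inj₂ ≡-Id) = contradiction (≡ₘ-trans (≡ₘ-sym mod-n) (≡ₘ-∣ (m∣m*n m) (MatEqMod⇒≡ₘ ≡-Id)))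
                                     (twoPower-≢-Id n∤2)
      from : 2 * n * m ∣ j → IsSolution (n * m) (replicate j a)
      from 2nm∣j =
        let 2∣j , n∣j , m∣j = Equivalence.to 2nm∣⇔ 2nm∣j
        in inj₁ (≡ₘ⇒MatEqMod (≡ₘ-* n⊥m
             (≡ₘ-trans mod-n (Equivalence.from twoPower-≡Id⇔ n∣j))
             (≡ₘ-trans mod-m (Equivalence.from (minusTwoPower-≡Id⇔ m∤2) (2∣j , m∣j)))))

    e₁₁-Mₙ-replicate≡1 : ∀ {J} → ¬ 2 ∣ J → + J ≡ 0ℤ ⟨mod n ⟩ → + J ≡ - + 2 ⟨mod m ⟩ →
                         e11 (Mₙ (replicate J a)) ≡ 1ℤ ⟨mod n * m ⟩
    e₁₁-Mₙ-replicate≡1 {J} 2∤J J≡0 J≡-2 = ≡mod-* n⊥m e₁₁≡1-mod-n e₁₁≡1-mod-m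
      where
      e₁₁≡1-mod-n : e11 (Mₙ (replicate J a)) ≡ 1ℤ ⟨mod n ⟩
      e₁₁≡1-mod-n = begin
        e11 (Mₙ (replicate J a))    ≈⟨ ≡₁₁ (Mₙ-replicate-mod-n J) ⟩
        1ℤ + + J                    ≈⟨ +-congˡ-mod 1ℤ J≡0 ⟩
        1ℤ + 0ℤ                     ∎
        where open ≡mod-Reasoning n
      e₁₁≡1-mod-m : e11 (Mₙ (replicate J a)) ≡ 1ℤ ⟨mod m ⟩
      e₁₁≡1-mod-m = begin
        e11 (Mₙ (replicate J a))    ≈⟨ ≡₁₁ (Mₙ-replicate-mod-m J) ⟩
        -1ℤ ^ J · (1ℤ + + J)        ≡⟨ cong (_· (1ℤ + + J)) (-1^-odd 2∤J) ⟩
        -1ℤ · (1ℤ + + J)            ≈⟨ ·-congˡ-mod -1ℤ (+-congˡ-mod 1ℤ J≡-2) ⟩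
        -1ℤ · (1ℤ + - + 2)          ∎
        where open ≡mod-Reasoning m

  border-exponent : ∃[ J ] 1 ≤ J × J ℕ.+ 3 ≤ 2 * n * m × ¬ 2 ∣ J × + J ≡ 0ℤ ⟨mod n ⟩ × + J ≡ - + 2 ⟨mod m ⟩
  border-exponent =
    let u , u≡0 , u≡-2 = crtℤ n⊥m 0ℤ (- + 2)
        J , J<2nm , J≡1 , J≡u = crt 2⊥nm {{ℕₚ.m*n≢0 2 (n * m)}} 1ℤ u
        2∤J = ≡1-mod-2⇒odd J≡1
        J≡0 = ≡mod-trans (≡mod-∣ (m∣m*n m) J≡u) u≡0
        J+n≤2nm = ∣-∣-<⇒+≤ (≡0-mod⇒∣ J≡0) (∣-trans (m∣m*n m) (n∣m*n 2)) J<2nm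
    in J , ℕ.>-nonZero⁻¹ J {{odd⇒nonZero 2∤J}} ,
       subst (J ℕ.+ 3 ≤_) (sym (ℕₚ.*-assoc 2 n m)) (ℕₚ.≤-trans (ℕₚ.+-monoʳ-≤ J 3≤n) J+n≤2nm) ,
       2∤J , J≡0 , ≡mod-trans (≡mod-∣ (n∣m*n n) J≡u) u≡-2

  module _ {k : ℕ} (k≡2 : + k ≡ + 2 ⟨mod n ⟩) (k≡-2 : + k ≡ - + 2 ⟨mod m ⟩) where

    k⊥nm : Coprime k (n * m)
    k⊥nm = coprime-* (≡mod-coprime k≡2 (odd⇒coprime-2 2∤n)) (≡mod-coprime k≡-2 (odd⇒coprime-2 2∤m))

    1≤k : 1 ≤ k
    1≤k = ℕₚ.n≢0⇒n>0 k≢0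
      where
      k≢0 : k ≢ 0
      k≢0 refl = n≢1 (ℕₚ.m*n≡1⇒m≡1 n m (Coprime.0-coprimeTo-m⇒m≡1 k⊥nm))

    monomial-minimal : IsMonomialMinimal (n * m) k (2 * n * m)
    monomial-minimal =
      ℕ.>-nonZero⁻¹ (2 * n * m) , Equivalence.from (monomial-solution⇔ k≡2 k≡-2) ∣-refl ,
      λ j 1≤j j<2nm solution →
        ℕₚ.<⇒≱ j<2nm (∣⇒≤ {{ℕ.>-nonZero 1≤j}} (Equivalence.to (monomial-solution⇔ k≡2 k≡-2) solution))

    monomial-reducible : Reducible (n * m) (replicate (2 * n * m) (+ k))
    monomial-reducible =
      let J , 1≤J , J+3≤2nm , 2∤J , J≡0 , J≡-2 = border-exponent
      in reducible-if-e₁₁≡1 1≤J J+3≤2nm (Equivalence.from (monomial-solution⇔ k≡2 k≡-2) ∣-refl)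
           (e₁₁-Mₙ-replicate≡1 k≡2 k≡-2 2∤J J≡0 J≡-2)

proposition5p1 : (n m : ℕ) → ¬ (2 ∣ n) → ¬ (2 ∣ m) → Coprime n m → n ≢ 1 → m ≢ 1 →
    Σ ℕ λ k → (1 ≤ k) × (k ≤ n * m ∸ 1) × Coprime k (n * m) ×
      IsMonomialMinimal (n * m) k (2 * n * m) ×
      Reducible (n * m) (replicate (2 * n * m) (+ k))
proposition5p1 n m 2∤n 2∤m n⊥m n≢1 m≢1 =
  let open OddCoprimeFactors 2∤n 2∤m n⊥m n≢1 m≢1
      k , k<nm , k≡2 , k≡-2 = crt n⊥m {{nm≢0}} (+ 2) (- + 2)
  in k , 1≤k k≡2 k≡-2 , ℕₚ.<⇒≤pred k<nm , k⊥nm k≡2 k≡-2 ,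
     monomial-minimal k≡2 k≡-2 , monomial-reducible k≡2 k≡-2
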